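{- Let $\mathscr{C}$ be a set system of non-empty subsets of a finite set $V$ satisfying (WP): whenever $A,B,C\in\mathscr{C}$ have pairwise non-empty intersections, one of them is contained in the union of the other two. Then $\mathscr{C}$ satisfies (I): for all $A,B,C\in\mathscr{C}$ with $\emptyset\neq A\cap B\subseteq C$ and $C\setminus(A\cup B)\neq\emptyset$, we have $A\subseteq C$ or $B\subseteq C$. -}

module Defs where

open import Data.Nat using (ℕ)
open import Data.Fin.Subset using (Subset; _⊆_; _∩_; _∪_; _─_; Nonempty)
open import Data.Product using (_×_)
open import Data.Sum using (_⊎_)

SetSystem : ℕ → Set₁
SetSystem n = Subset n → Set

AllNonempty : ∀ {n} → SetSystem n → Set
AllNonempty {n} 𝒞 = ∀ (A : Subset n) → 𝒞 A → Nonempty A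

WP : ∀ {n} → SetSystem n → Set
WP {n} 𝒞 = ∀ (A B C : Subset n) → 𝒞 A → 𝒞 B → 𝒞 C →
  Nonempty (A ∩ B) → Nonempty (B ∩ C) → Nonempty (A ∩ C) →
  (A ⊆ B ∪ C) ⊎ (B ⊆ A ∪ C) ⊎ (C ⊆ A ∪ B)

PropI : ∀ {n} → SetSystem n → Set
PropI {n} 𝒞 = ∀ (A B C : Subset n) → 𝒞 A → 𝒞 B → 𝒞 C →
  Nonempty (A ∩ B) → (A ∩ B) ⊆ C → Nonempty (C ─ (A ∪ B)) →
  (A ⊆ C) ⊎ (B ⊆ C)

-- A point of A ∩ B lies in C, so A, B, C pairwise intersect and (WP) applies.
-- The alternative C ⊆ A ∪ B is ruled out by a point of C ∖ (A ∪ B), while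
-- A ⊆ B ∪ C together with A ∩ B ⊆ C already forces A ⊆ C (and symmetrically for B).
module Submission where

open import Defs
open import Data.Nat using (ℕ)
open import Data.Fin.Subset using (Subset; _∈_; _∉_; _⊆_; _∩_; _∪_; _─_; Nonempty; inside; outside)
open import Data.Fin.Subset.Properties using (x∈p∩q⁺; x∈p∩q⁻; x∈p∪q⁻; p─q⊆p; ∩-comm)
open import Data.Vec using (_∷_; here; there)
open import Data.Product using (_,_)
open import Data.Sum using (inj₁; inj₂)
open import Data.Empty using (⊥-elim)
open import Relation.Binary.PropositionalEquality using (subst)
open import Relation.Nullary using (¬_)

x∈p─q⇒x∉q : ∀ {n} (p q : Subset n) {x} → x ∈ p ─ q → x ∉ q
x∈p─q⇒x∉q (inside ∷ p) (outside ∷ q) here        ()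
x∈p─q⇒x∉q (_      ∷ p) (_       ∷ q) (there x∈) (there x∈q) = x∈p─q⇒x∉q p q x∈ x∈q

Nonempty-─⇒⊈ : ∀ {n} (p q : Subset n) → Nonempty (p ─ q) → ¬ (p ⊆ q)
Nonempty-─⇒⊈ p q (x , x∈p─q) p⊆q = x∈p─q⇒x∉q p q x∈p─q (p⊆q (p─q⊆p p q x∈p─q))

p∩q⊆r∧p⊆q∪r⇒p⊆r : ∀ {n} {p q r : Subset n} → p ∩ q ⊆ r → p ⊆ q ∪ r → p ⊆ r
p∩q⊆r∧p⊆q∪r⇒p⊆r {q = q} {r} p∩q⊆r p⊆q∪r {x} x∈p with x∈p∪q⁻ q r (p⊆q∪r x∈p)
... | inj₁ x∈q = p∩q⊆r (x∈p∩q⁺ (x∈p , x∈q))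
... | inj₂ x∈r = x∈r

mainTheorem7 : (n : ℕ) (𝒞 : SetSystem n) → AllNonempty 𝒞 → WP 𝒞 → PropI 𝒞
mainTheorem7 n 𝒞 _ wp A B C A∈𝒞 B∈𝒞 C∈𝒞 (x , x∈A∩B) A∩B⊆C C─A∪B≠∅
  with x∈p∩q⁻ A B x∈A∩B
... | x∈A , x∈B
  with wp A B C A∈𝒞 B∈𝒞 C∈𝒞 (x , x∈A∩B) (x , x∈p∩q⁺ (x∈B , x∈C)) (x , x∈p∩q⁺ (x∈A , x∈C))
  where
  x∈C : x ∈ C
  x∈C = A∩B⊆C x∈A∩B
... | inj₁ A⊆B∪C        = inj₁ (p∩q⊆r∧p⊆q∪r⇒p⊆r A∩B⊆C A⊆B∪C)
... | inj₂ (inj₁ B⊆A∪C) = inj₂ (p∩q⊆r∧p⊆q∪r⇒p⊆r (subst (_⊆ C) (∩-comm A B) A∩B⊆C) B⊆A∪C)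
... | inj₂ (inj₂ C⊆A∪B) = ⊥-elim (Nonempty-─⇒⊈ C (A ∪ B) C─A∪B≠∅ C⊆A∪B)
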